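{- Let $\ell\ge2$ be an integer and let $x<y<z$ be consecutive numbers in $\overline{\mathcal{V}}_\ell$, not all contained in $\overline{\mathcal{V}}_{\ell+1}$. Then exactly one of the following holds: (i) $\bar\alpha(x)\ge F_{\ell+1}$, $\bar\alpha(y)=F_\ell$, $\bar\alpha(z)\ge F_{\ell+1}$ and $z-x=F_\ell$; (ii) $\bar\alpha(x)=F_\ell$, $\bar\alpha(y)\ge F_{\ell+1}$, $\bar\alpha(z)=F_\ell$ and $y-x=z-y$; (iii) $\bar\alpha(x)=F_\ell$, $\bar\alpha(y)=F_{\ell+1}$, $\bar\alpha(z)\ge F_{\ell+2}$ and $y-x=z-y=F_{\ell-1}$; (iv) $\bar\alpha(x)\ge F_{\ell+2}$, $\bar\alpha(y)=F_{\ell+1}$, $\bar\alpha(z)=F_\ell$ and $y-x=z-y=F_{\ell-1}$.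
   Context: Fibonacci numbers: $F_{ -1}=0$, $F_0=1$, $F_{i+2}=F_{i+1}+F_i$; $\overline{\mathcal{F}}=\{F_i: i\ge-1\}$. Define $\bar\iota:\mathbb{N}\to\mathbb{N}$ by $\bar\iota(x)=x$ if $x\in\overline{\mathcal{F}}$, and $\bar\iota(x)=x-2F_{i-2}$ if $F_i<x<F_{i+1}$ for an integer $i\ge3$; $\bar\alpha(x)=\lim_k\bar\iota^k(x)$; $\overline{\mathcal{V}}_\ell=\{x\in\mathbb{N}: \bar\alpha(x)\ge F_\ell\}$. Elements $x_1<\dots<x_k$ of $\overline{\mathcal{V}}_\ell$ are consecutive if they are all the elements of $\overline{\mathcal{V}}_\ell\cap[x_1,x_k]$. -}

module Defs where

open import Data.Nat using (ℕ; zero; suc; _+_; _*_; _∸_; _≤_; _<_; _≡ᵇ_; _≤ᵇ_; _<ᵇ_)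
open import Data.Bool using (Bool; true; false; _∧_; _∨_; if_then_else_)
open import Data.Maybe using (Maybe; just; nothing)
open import Data.Product using (_×_; ∃)
open import Data.Sum using (_⊎_)
open import Relation.Nullary using (¬_)
open import Relation.Binary.PropositionalEquality using (_≡_)
open import Function using (_∘_)

-- F i = F_i of the paper for i ≥ 0 (F_0 = F_1 = 1, F_2 = 2, ...).
-- The paper's F_{-1} = 0 is handled separately in the set F̄ below.
F : ℕ → ℕ
F zero = 1
F (suc zero) = 1
F (suc (suc i)) = F (suc i) + F i

-- Boolean decision of membership in F̄ (since F i ≥ i, any index i with
-- F i ≡ x satisfies i ≤ x, so searching i ∈ [0, x] suffices).
anyFibUpTo : ℕ → ℕ → Bool
anyFibUpTo x zero = F zero ≡ᵇ x
anyFibUpTo x (suc n) = (F (suc n) ≡ᵇ x) ∨ anyFibUpTo x n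

isFibBar : ℕ → Bool
isFibBar x = (x ≡ᵇ 0) ∨ anyFibUpTo x x

findIndex : ℕ → ℕ → Maybe ℕ
findIndex x zero = nothing
findIndex x (suc n) =
  if (3 ≤ᵇ n) ∧ (F n <ᵇ x) ∧ (x <ᵇ F (suc n)) then just n else findIndex x n

-- ῑ(x) = x if x ∈ F̄; ῑ(x) = x - 2 F_{i-2} if F_i < x < F_{i+1}, i ≥ 3.
-- (Such an i, if it exists, satisfies i ≤ x since F i ≥ i.)
iotaStep : ℕ → Maybe ℕ → ℕ
iotaStep x (just i) = x ∸ 2 * F (i ∸ 2)
iotaStep x nothing = x

iotaBar : ℕ → ℕ
iotaBar x = if isFibBar x then x else iotaStep x (findIndex x (suc x))

iterate : (ℕ → ℕ) → ℕ → ℕ → ℕ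
iterate f zero x = x
iterate f (suc k) x = iterate f k (f x)

-- ᾱ(x) = lim_k ῑ^k(x).  The sequence ῑ^k(x) strictly decreases until it
-- reaches a fixed point (an element of F̄), hence is constant from k = x on;
-- so the limit equals ῑ^x(x).
alphaBar : ℕ → ℕ
alphaBar x = iterate iotaBar x x

V : ℕ → ℕ → Set
V ℓ x = F ℓ ≤ alphaBar x

Consecutive3 : ℕ → ℕ → ℕ → ℕ → Set
Consecutive3 ℓ x y z =
  x < y × y < z × V ℓ x × V ℓ y × V ℓ z ×
  (∀ w → x ≤ w → w ≤ z → V ℓ w → w ≡ x ⊎ w ≡ y ⊎ w ≡ z)

ExactlyOne4 : Set → Set → Set → Set → Set
ExactlyOne4 A B C D =
  (A ⊎ B ⊎ C ⊎ D) ×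
  ¬ (A × B) × ¬ (A × C) × ¬ (A × D) × ¬ (B × C) × ¬ (B × D) × ¬ (C × D)

-- For i ≥ 3 and F i < F i + t < F (i + 1), ῑ replaces F i + t by F (i - 3) + t, so ᾱ is
-- invariant under the shift F (j + 3) + t ↦ F j + t (0 < t < F (j + 2)); from this one derives,
-- by induction on k, the mirror symmetry ᾱ (F (k + 2) - t) = ᾱ (F (k + 2) + t) for 0 < t < F (k + 1).
-- Hence the two elements of V̄ ℓ on either side of F i (i ≥ ℓ) and their ᾱ-values depend only
-- on i mod 3, and are computed from the three base cases i = ℓ - 1, ℓ, ℓ + 1.  A consecutive
-- triple x < y < z either contains some F i, and is then read off from these neighbourhoods,
-- or lies strictly between F (j + 3) and F (j + 4), where the shift carries it to a triple
-- starting below x with the same ᾱ-values and gaps; this gives an induction on x.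

module Submission where

open import Defs
open import Data.Nat using (ℕ; zero; suc; _+_; _*_; _∸_; _≤_; _<_; _≤ᵇ_; _≡ᵇ_; z≤n; s≤s)
open import Data.Nat.Properties
open import Data.Nat.Induction using (<-wellFounded)
open import Data.Nat.Tactic.RingSolver using (solve-∀)
open import Data.Bool using (true; false; _∧_; _∨_; T)
open import Data.Bool.Properties using (∨-zeroʳ; ∧-zeroʳ; T-≡)
open import Data.Maybe using (just; nothing)
open import Data.Product using (_×_; _,_; ∃; proj₁; proj₂)
open import Data.Sum using (_⊎_; inj₁; inj₂)
import Data.Sum as Sum
open import Data.Unit using (tt)
open import Function using (_∘_)
open import Function.Bundles using (Equivalence)
open import Induction.WellFounded using (Acc; acc)
open import Relation.Binary using (tri<; tri≈; tri>)
open import Relation.Binary.PropositionalEquality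
open import Relation.Nullary using (¬_; yes; no; contradiction)

F-pos : ∀ n → 0 < F n
F-pos zero = s≤s z≤n
F-pos (suc zero) = s≤s z≤n
F-pos (suc (suc n)) = ≤-trans (F-pos (suc n)) (m≤m+n _ _)

F-≤-suc : ∀ n → F n ≤ F (suc n)
F-≤-suc zero = ≤-refl
F-≤-suc (suc n) = m≤m+n _ _

F-<-suc : ∀ n → F (suc n) < F (suc (suc n))
F-<-suc n = m<m+n (F (suc n)) (F-pos n)

F-mono-≤ : ∀ {m n} → m ≤ n → F m ≤ F n
F-mono-≤ {n = zero} z≤n = ≤-refl
F-mono-≤ {m} {suc n} m≤1+n with m≤n⇒m<n∨m≡n m≤1+n
... | inj₁ m<1+n = ≤-trans (F-mono-≤ (≤-pred m<1+n)) (F-≤-suc n)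
... | inj₂ refl = ≤-refl

F-mono-< : ∀ {m n} → 0 < m → m < n → F m < F n
F-mono-< {suc m} _ m<n = <-≤-trans (F-<-suc m) (F-mono-≤ m<n)

F-cancel-≤ : ∀ {ℓ i} → 2 ≤ ℓ → F ℓ ≤ F i → ℓ ≤ i
F-cancel-≤ {ℓ} {i} 2≤ℓ Fℓ≤Fi with ℓ ≤? i
... | yes ℓ≤i = ℓ≤i
... | no ℓ≰i = contradiction Fℓ≤Fi (<⇒≱ (below i (≰⇒> ℓ≰i)))
  where
  below : ∀ i → i < ℓ → F i < F ℓ
  below zero _ = F-mono-≤ 2≤ℓ
  below (suc i) i<ℓ = F-mono-< (s≤s z≤n) i<ℓ

n≤F[n] : ∀ n → n ≤ F n
n≤F[n] zero = z≤n
n≤F[n] (suc zero) = s≤s z≤n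
n≤F[n] (suc (suc n)) =
  subst (_≤ F (suc n) + F n) (+-comm (suc n) 1) (+-mono-≤ (n≤F[n] (suc n)) (F-pos n))

F-bracket : ∀ x → 0 < x → ∃ λ i → F (1 + i) ≤ x × x < F (2 + i)
F-bracket x 0<x = search x (<-≤-trans (s≤s (n≤1+n x)) (n≤F[n] (2 + x)))
  where
  search : ∀ k → x < F (2 + k) → ∃ λ i → F (1 + i) ≤ x × x < F (2 + i)
  search zero x<2 = 0 , 0<x , x<2
  search (suc k) x<F with x <? F (2 + k)
  ... | yes x<F′ = search k x<F′
  ... | no x≮F′ = suc k , ≮⇒≥ x≮F′ , x<F

F-locate : ∀ x → 2 ≤ x → (∃ λ i → F i ≡ x) ⊎ (∃ λ j → F (3 + j) < x × x < F (4 + j))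
F-locate x 2≤x with F-bracket x (≤-trans (s≤s z≤n) 2≤x)
... | 0 , _ , x<2 = contradiction 2≤x (<⇒≱ x<2)
... | 1 , 2≤x′ , x<3 = inj₁ (2 , ≤-antisym 2≤x′ (≤-pred x<3))
... | suc (suc j) , F≤x , x<F with F (3 + j) ≟ x
...   | yes F≡x = inj₁ (3 + j , F≡x)
...   | no F≢x = inj₂ (j , ≤∧≢⇒< F≤x F≢x , x<F)

¬T⇒≡false : ∀ {b} → ¬ T b → b ≡ false
¬T⇒≡false {false} _ = refl
¬T⇒≡false {true} ¬t = contradiction tt ¬t

anyFibUpTo-F : ∀ {i} n → i ≤ n → anyFibUpTo (F i) n ≡ true
anyFibUpTo-F zero z≤n = refl
anyFibUpTo-F {i} (suc n) i≤1+n with m≤n⇒m<n∨m≡n i≤1+n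
... | inj₁ i<1+n =
  trans (cong ((F (suc n) ≡ᵇ F i) ∨_) (anyFibUpTo-F n (≤-pred i<1+n))) (∨-zeroʳ _)
... | inj₂ refl = cong (_∨ anyFibUpTo (F i) n) (Equivalence.to T-≡ (≡⇒≡ᵇ (F i) (F i) refl))

anyFibUpTo-¬F : ∀ {x} n → (∀ {j} → j ≤ n → F j ≢ x) → anyFibUpTo x n ≡ false
anyFibUpTo-¬F zero ¬F = ¬T⇒≡false (¬F z≤n ∘ ≡ᵇ⇒≡ _ _)
anyFibUpTo-¬F (suc n) ¬F rewrite ¬T⇒≡false (¬F ≤-refl ∘ ≡ᵇ⇒≡ (F (suc n)) _) =
  anyFibUpTo-¬F n (¬F ∘ m≤n⇒m≤1+n)

isFibBar-F : ∀ i → isFibBar (F i) ≡ true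
isFibBar-F i = trans (cong ((F i ≡ᵇ 0) ∨_) (anyFibUpTo-F (F i) (n≤F[n] i))) (∨-zeroʳ _)

isFibBar-between : ∀ {i x} → F i < x → x < F (suc i) → isFibBar x ≡ false
isFibBar-between {i} {x} Fi<x x<Fi+1
  rewrite ¬T⇒≡false (<⇒≢ (≤-<-trans z≤n Fi<x) ∘ sym ∘ ≡ᵇ⇒≡ x 0) = anyFibUpTo-¬F x Fj≢x
  where
  Fj≢x : ∀ {j} → j ≤ x → F j ≢ x
  Fj≢x {j} _ Fj≡x with j ≤? i
  ... | yes j≤i = <⇒≱ Fi<x (subst (_≤ F i) Fj≡x (F-mono-≤ j≤i))
  ... | no j≰i = <⇒≱ x<Fi+1 (subst (F (suc i) ≤_) Fj≡x (F-mono-≤ (≰⇒> j≰i)))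

findIndex-between : ∀ {i x} → 3 ≤ i → F i < x → x < F (suc i) → findIndex x (suc x) ≡ just i
findIndex-between {i} {x} 3≤i Fi<x x<Fi+1 =
  search (suc x) (s≤s (≤-trans (n≤F[n] i) (<⇒≤ Fi<x)))
  where
  Fn≮x : ∀ {n} → i < n → ¬ F n < x
  Fn≮x i<n Fn<x = <⇒≱ x<Fi+1 (≤-trans (F-mono-≤ i<n) (<⇒≤ Fn<x))

  search : ∀ n → i < n → findIndex x n ≡ just i
  search (suc n) i<1+n with m≤n⇒m<n∨m≡n (≤-pred i<1+n)
  ... | inj₁ i<n rewrite ¬T⇒≡false (Fn≮x i<n ∘ <ᵇ⇒< (F n) x) | ∧-zeroʳ (3 ≤ᵇ n) = search n i<n
  ... | inj₂ refl
    rewrite Equivalence.to T-≡ (≤⇒≤ᵇ 3≤i) | Equivalence.to T-≡ (<⇒<ᵇ Fi<x)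
          | Equivalence.to T-≡ (<⇒<ᵇ x<Fi+1) = refl

iotaBar-F : ∀ i → iotaBar (F i) ≡ F i
iotaBar-F i rewrite isFibBar-F i = refl

iotaBar-between : ∀ {i x} → 3 ≤ i → F i < x → x < F (suc i) → iotaBar x ≡ x ∸ 2 * F (i ∸ 2)
iotaBar-between {i} 3≤i Fi<x x<Fi+1
  rewrite isFibBar-between {i} Fi<x x<Fi+1 | findIndex-between {i} 3≤i Fi<x x<Fi+1 = refl

iotaBar-≤ : ∀ x → iotaBar x ≤ x
iotaBar-≤ x with isFibBar x
... | true = ≤-refl
... | false with findIndex x (suc x)
...   | just i = m∸n≤m x (2 * F (i ∸ 2))
...   | nothing = ≤-refl

module _ {f : ℕ → ℕ} where

  iterate-fixed : ∀ k {x} → f x ≡ x → iterate f k x ≡ x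
  iterate-fixed zero _ = refl
  iterate-fixed (suc k) fx≡x rewrite fx≡x = iterate-fixed k fx≡x

  module _ (f≤id : ∀ x → f x ≤ x) where

    iterate-≤ : ∀ k x → iterate f k x ≤ x
    iterate-≤ zero x = ≤-refl
    iterate-≤ (suc k) x = ≤-trans (iterate-≤ k (f x)) (f≤id x)

    iterate-suc-stable : ∀ k {x} → x ≤ k → iterate f (suc k) x ≡ iterate f k x
    iterate-suc-stable zero z≤n = n≤0⇒n≡0 (f≤id 0)
    iterate-suc-stable (suc k) {x} x≤1+k with m≤n⇒m<n∨m≡n (f≤id x)
    ... | inj₁ fx<x = iterate-suc-stable k (≤-pred (<-≤-trans fx<x x≤1+k))
    ... | inj₂ fx≡x =
      trans (iterate-fixed (suc k) (cong f fx≡x)) (sym (iterate-fixed k (cong f fx≡x)))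

    iterate-stable : ∀ k {x} → x ≤ k → iterate f k x ≡ iterate f x x
    iterate-stable zero z≤n = refl
    iterate-stable (suc k) x≤1+k with m≤n⇒m<n∨m≡n x≤1+k
    ... | inj₁ (s≤s x≤k) = trans (iterate-suc-stable k x≤k) (iterate-stable k x≤k)
    ... | inj₂ refl = refl

    iterate-diagonal-∘ : ∀ x → iterate f (f x) (f x) ≡ iterate f x x
    iterate-diagonal-∘ x with m≤n⇒m<n∨m≡n (f≤id x)
    ... | inj₂ fx≡x = cong (λ y → iterate f y y) fx≡x
    ... | inj₁ (s≤s fx≤x-1) = sym (iterate-stable _ fx≤x-1)

alphaBar-F : ∀ i → alphaBar (F i) ≡ F i
alphaBar-F i = iterate-fixed (F i) (iotaBar-F i)

alphaBar-≤ : ∀ x → alphaBar x ≤ x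
alphaBar-≤ x = iterate-≤ iotaBar-≤ x x

alphaBar-iotaBar : ∀ x → alphaBar (iotaBar x) ≡ alphaBar x
alphaBar-iotaBar = iterate-diagonal-∘ iotaBar-≤

Agree : ℕ → ℕ → ℕ → Set
Agree p q d = ∀ {t} → 0 < t → t < d → alphaBar (p + t) ≡ alphaBar (q + t)

alphaBar-shift : ∀ j → Agree (F (3 + j)) (F j) (F (2 + j))
alphaBar-shift j {t} 0<t t<F = begin
  alphaBar (F (3 + j) + t)                  ≡⟨ alphaBar-iotaBar (F (3 + j) + t) ⟨
  alphaBar (iotaBar (F (3 + j) + t))        ≡⟨ cong alphaBar (iotaBar-between 3≤3+j F<F+t F+t<F) ⟩
  alphaBar (F (3 + j) + t ∸ 2 * F (1 + j))  ≡⟨ cong alphaBar F+t∸2F≡F+t ⟩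
  alphaBar (F j + t)                        ∎
  where
  open ≡-Reasoning
  3≤3+j : 3 ≤ 3 + j
  3≤3+j = s≤s (s≤s (s≤s z≤n))
  F<F+t : F (3 + j) < F (3 + j) + t
  F<F+t = m<m+n (F (3 + j)) 0<t
  F+t<F : F (3 + j) + t < F (4 + j)
  F+t<F = +-monoʳ-< (F (3 + j)) t<F
  unfold : ∀ a b t → a + b + a + t ≡ 2 * a + (b + t)
  unfold = solve-∀
  F+t∸2F≡F+t : F (3 + j) + t ∸ 2 * F (1 + j) ≡ F j + t
  F+t∸2F≡F+t = trans (cong (_∸ 2 * F (1 + j)) (unfold (F (1 + j)) (F j) t))
                     (m+n∸m≡n (2 * F (1 + j)) (F j + t))

alphaBar-reflect : ∀ k {u y} → u + y ≡ F (2 + k) → 0 < y → y < F (1 + k) →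
                   alphaBar u ≡ alphaBar (F (2 + k) + y)
alphaBar-reflect zero _ 0<y y<1 = contradiction 0<y (<⇒≱ y<1)
alphaBar-reflect (suc k) {u} {y} u+y≡F 0<y y<F =
  trans (toShifted (<-cmp y (F (1 + k)))) (sym (alphaBar-shift k 0<y y<F))
  where
  toShifted : _ → alphaBar u ≡ alphaBar (F k + y)
  toShifted (tri≈ _ refl _) = cong alphaBar (trans u≡F[2+k] (+-comm (F (1 + k)) (F k)))
    where
    u≡F[2+k] : u ≡ F (2 + k)
    u≡F[2+k] = +-cancelʳ-≡ y u (F (2 + k)) u+y≡F
  toShifted (tri< y<F[1+k] _ _) =
    trans (cong alphaBar u≡F[2+k]+s) (sym (alphaBar-reflect k F[k]+y+s≡F[2+k] 0<s s<F[1+k]))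
    where
    s = F (1 + k) ∸ y
    y+s≡F[1+k] : y + s ≡ F (1 + k)
    y+s≡F[1+k] = m+[n∸m]≡n (<⇒≤ y<F[1+k])
    0<s : 0 < s
    0<s = m<n⇒0<n∸m y<F[1+k]
    s<F[1+k] : s < F (1 + k)
    s<F[1+k] = ∸-monoʳ-< 0<y (<⇒≤ y<F[1+k])
    F[k]+y+s≡F[2+k] : F k + y + s ≡ F (2 + k)
    F[k]+y+s≡F[2+k] = trans (+-assoc (F k) y s) (trans (cong (F k +_) y+s≡F[1+k]) (+-comm (F k) (F (1 + k))))
    swap : ∀ a y s → a + (y + s) ≡ a + s + y
    swap = solve-∀
    u≡F[2+k]+s : u ≡ F (2 + k) + s
    u≡F[2+k]+s = +-cancelʳ-≡ y u (F (2 + k) + s)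
                   (trans u+y≡F (trans (cong (F (2 + k) +_) (sym y+s≡F[1+k])) (swap (F (2 + k)) y s)))
  toShifted (tri> _ _ F[1+k]<y) =
    trans (alphaBar-reflect k u+s≡F[2+k] 0<s s<F[1+k]) (cong alphaBar F[2+k]+s≡F[k]+y)
    where
    s = y ∸ F (1 + k)
    F[1+k]+s≡y : F (1 + k) + s ≡ y
    F[1+k]+s≡y = m+[n∸m]≡n (<⇒≤ F[1+k]<y)
    0<s : 0 < s
    0<s = m<n⇒0<n∸m F[1+k]<y
    s<F[1+k] : s < F (1 + k)
    s<F[1+k] = <-≤-trans (subst (s <_) (m+n∸m≡n (F (1 + k)) (F k)) (∸-monoˡ-< y<F (<⇒≤ F[1+k]<y)))
                         (F-≤-suc k)
    swap : ∀ u a s → u + s + a ≡ u + (a + s)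
    swap = solve-∀
    u+s≡F[2+k] : u + s ≡ F (2 + k)
    u+s≡F[2+k] = +-cancelʳ-≡ (F (1 + k)) (u + s) (F (2 + k))
                   (trans (swap u (F (1 + k)) s) (trans (cong (u +_) F[1+k]+s≡y) u+y≡F))
    rearrange : ∀ a b s → a + b + s ≡ b + (a + s)
    rearrange = solve-∀
    F[2+k]+s≡F[k]+y : F (2 + k) + s ≡ F k + y
    F[2+k]+s≡F[k]+y = trans (rearrange (F (1 + k)) (F k) s) (cong (F k +_) F[1+k]+s≡y)

Mirror : ℕ → ℕ → Set
Mirror p d = ∀ {t} → 0 < t → t < d → alphaBar (p ∸ t) ≡ alphaBar (p + t)

alphaBar-mirror : ∀ k → Mirror (F (2 + k)) (F (1 + k))
alphaBar-mirror k 0<t t<F =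
  alphaBar-reflect k (m∸n+n≡m (≤-trans (<⇒≤ t<F) (F-≤-suc (1 + k)))) 0<t t<F

V⇒F≤ : ∀ {ℓ x} → V ℓ x → F ℓ ≤ x
V⇒F≤ {x = x} Vx = ≤-trans Vx (alphaBar-≤ x)

Gap : ℕ → ℕ → ℕ → Set
Gap ℓ a b = ∀ {w} → a < w → w < b → ¬ V ℓ w

Gap-below : ∀ {ℓ a b} → b ≤ F ℓ → Gap ℓ a b
Gap-below {ℓ} b≤F _ w<b Vw = <⇒≱ (<-≤-trans w<b b≤F) (V⇒F≤ {ℓ} Vw)

Gap-⊆ : ∀ {ℓ a b c d} → a ≤ c → d ≤ b → Gap ℓ a b → Gap ℓ c d
Gap-⊆ a≤c d≤b gap c<w w<d = gap (≤-<-trans a≤c c<w) (<-≤-trans w<d d≤b)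

Gap-transport : ∀ {ℓ} p q {d a b} → Agree p q d → b ≤ d →
                Gap ℓ (q + a) (q + b) → Gap ℓ (p + a) (p + b)
Gap-transport {ℓ} p q {d} {a} {b} agree b≤d gap {w} p+a<w w<p+b Vw
  with m≤n⇒∃[o]m+o≡n (≤-trans (m≤m+n p a) (<⇒≤ p+a<w))
... | t , refl =
  gap (+-monoʳ-< q a<t) (+-monoʳ-< q t<b) (subst (F ℓ ≤_) (agree 0<t (<-≤-trans t<b b≤d)) Vw)
  where
  a<t = +-cancelˡ-< p a t p+a<w
  t<b = +-cancelˡ-< p t b w<p+b
  0<t = ≤-<-trans z≤n a<t

-- The case a = 0 of Gap-transport, stated separately because p + 0 does not reduce to p.
Gap-transport₀ : ∀ {ℓ} p q {d b} → Agree p q d → b ≤ d → Gap ℓ q (q + b) → Gap ℓ p (p + b)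
Gap-transport₀ {ℓ} p q agree b≤d gap =
  Gap-⊆ {ℓ} (≤-reflexive (+-identityʳ p)) ≤-refl
    (Gap-transport {ℓ} p q agree b≤d (Gap-⊆ {ℓ} (≤-reflexive (sym (+-identityʳ q))) ≤-refl gap))

Gap-reflect : ∀ {ℓ p d a b} → Mirror p d → a ≤ b → b ≤ d → b ≤ p →
              Gap ℓ (p + a) (p + b) → Gap ℓ (p ∸ b) (p ∸ a)
Gap-reflect {ℓ} {p} {d} {a} {b} mirror a≤b b≤d b≤p gap {w} p∸b<w w<p∸a Vw =
  gap (+-monoʳ-< p a<t) (+-monoʳ-< p t<b) (subst (F ℓ ≤_) α[w]≡α[p+t] Vw)
  where
  w≤p = ≤-trans (<⇒≤ w<p∸a) (m∸n≤m p a)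
  t = p ∸ w
  p∸t≡w = m∸[m∸n]≡n w≤p
  a<t = subst (_< t) (m∸[m∸n]≡n (≤-trans a≤b b≤p)) (∸-monoʳ-< w<p∸a (m∸n≤m p a))
  t<b = subst (t <_) (m∸[m∸n]≡n b≤p) (∸-monoʳ-< p∸b<w w≤p)
  α[w]≡α[p+t] = trans (cong alphaBar (sym p∸t≡w)) (mirror (≤-<-trans z≤n a<t) (<-≤-trans t<b b≤d))

Gap-F : ∀ k → Gap (2 + k) (F (2 + k)) (F (3 + k))
Gap-F zero 2<w w<3 _ = <⇒≱ w<3 2<w
Gap-F (suc k) =
  Gap-transport₀ {3 + k} (F (3 + k)) (F k) (alphaBar-shift k) ≤-refl (Gap-below {3 + k} below)
  where
  below : F k + F (2 + k) ≤ F (3 + k)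
  below = subst (_≤ F (3 + k)) (+-comm (F (2 + k)) (F k)) (+-monoʳ-≤ (F (2 + k)) (F-≤-suc k))

V-F : ∀ {ℓ i} → ℓ ≤ i → V ℓ (F i)
V-F {ℓ} {i} ℓ≤i = subst (F ℓ ≤_) (sym (alphaBar-F i)) (F-mono-≤ ℓ≤i)

Next : ℕ → ℕ → ℕ → Set
Next ℓ a b = a < b × Gap ℓ a b × V ℓ b

Next-unique : ∀ {ℓ a b c} → Next ℓ a b → Next ℓ a c → b ≡ c
Next-unique {b = b} {c} (a<b , gapb , Vb) (a<c , gapc , Vc) with <-cmp b c
... | tri< b<c _ _ = contradiction Vb (gapc a<b b<c)
... | tri≈ _ b≡c _ = b≡c
... | tri> _ _ c<b = contradiction Vc (gapb a<c c<b)

Next-injective : ∀ {ℓ a a′ b} → V ℓ a → V ℓ a′ → Next ℓ a b → Next ℓ a′ b → a ≡ a′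
Next-injective {a = a} {a′} Va Va′ (a<b , gap , _) (a′<b , gap′ , _) with <-cmp a a′
... | tri< a<a′ _ _ = contradiction Va′ (gap a<a′ a′<b)
... | tri≈ _ a≡a′ _ = a≡a′
... | tri> _ _ a′<a = contradiction Va (gap′ a′<a a<b)

Chain : ℕ → ℕ → ℕ → ℕ → Set
Chain ℓ a b c = V ℓ a × Next ℓ a b × Next ℓ b c

Consecutive3⇒Chain : ∀ {ℓ x y z} → Consecutive3 ℓ x y z → Chain ℓ x y z
Consecutive3⇒Chain {ℓ} {x} {y} {z} (x<y , y<z , Vx , Vy , Vz , onlyXYZ) =
  Vx , (x<y , gapxy , Vy) , (y<z , gapyz , Vz)
  where
  gapxy : Gap ℓ x y
  gapxy {w} x<w w<y Vw with onlyXYZ w (<⇒≤ x<w) (<⇒≤ (<-trans w<y y<z)) Vw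
  ... | inj₁ refl = <-irrefl refl x<w
  ... | inj₂ (inj₁ refl) = <-irrefl refl w<y
  ... | inj₂ (inj₂ refl) = <-asym w<y y<z
  gapyz : Gap ℓ y z
  gapyz {w} y<w w<z Vw with onlyXYZ w (<⇒≤ (<-trans x<y y<w)) (<⇒≤ w<z) Vw
  ... | inj₁ refl = <-asym x<y y<w
  ... | inj₂ (inj₁ refl) = <-irrefl refl y<w
  ... | inj₂ (inj₂ refl) = <-irrefl refl w<z

Chain-≡ : ∀ {ℓ a b c x y z} → Chain ℓ a b c → Chain ℓ x y z →
          a ≡ x ⊎ b ≡ y ⊎ c ≡ z → a ≡ x × b ≡ y × c ≡ z
Chain-≡ {ℓ} (_ , ab , bc) (_ , xy , yz) (inj₁ refl) with Next-unique {ℓ} ab xy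
... | refl = refl , refl , Next-unique {ℓ} bc yz
Chain-≡ {ℓ} (Va , ab , bc) (Vx , xy , yz) (inj₂ (inj₁ refl))
  with Next-injective {ℓ} Va Vx ab xy
... | refl = refl , refl , Next-unique {ℓ} bc yz
Chain-≡ {ℓ} (Va , ab@(_ , _ , Vb) , bc) (Vx , xy@(_ , _ , Vy) , yz) (inj₂ (inj₂ refl))
  with Next-injective {ℓ} Vb Vy bc yz
... | refl with Next-injective {ℓ} Va Vx ab xy
...   | refl = refl , refl , refl

Chain-V : ∀ {ℓ p x y z} → Chain ℓ x y z → p ≡ x ⊎ p ≡ y ⊎ p ≡ z → V ℓ p
Chain-V (Vx , _) (inj₁ refl) = Vx
Chain-V (_ , (_ , _ , Vy) , _) (inj₂ (inj₁ refl)) = Vy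
Chain-V (_ , _ , (_ , _ , Vz)) (inj₂ (inj₂ refl)) = Vz

Consecutive3-transport : ∀ {ℓ} p q {d a b c} → Agree p q d → 0 < a → c < d →
  Consecutive3 ℓ (p + a) (p + b) (p + c) → Consecutive3 ℓ (q + a) (q + b) (q + c)
Consecutive3-transport {ℓ} p q {d} {a} {b} {c} agree 0<a c<d
                       (pa<pb , pb<pc , Va , Vb , Vc , onlyABC) =
  +-monoʳ-< q a<b , +-monoʳ-< q b<c ,
  subst (F ℓ ≤_) (agreeOn ≤-refl (<⇒≤ (<-trans a<b b<c))) Va ,
  subst (F ℓ ≤_) (agreeOn (<⇒≤ a<b) (<⇒≤ b<c)) Vb ,
  subst (F ℓ ≤_) (agreeOn (<⇒≤ (<-trans a<b b<c)) ≤-refl) Vc ,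
  onlyQABC
  where
  a<b = +-cancelˡ-< p a b pa<pb
  b<c = +-cancelˡ-< p b c pb<pc
  agreeOn : ∀ {t} → a ≤ t → t ≤ c → alphaBar (p + t) ≡ alphaBar (q + t)
  agreeOn a≤t t≤c = agree (<-≤-trans 0<a a≤t) (≤-<-trans t≤c c<d)
  onlyQABC : ∀ w → q + a ≤ w → w ≤ q + c → V ℓ w → w ≡ q + a ⊎ w ≡ q + b ⊎ w ≡ q + c
  onlyQABC w qa≤w w≤qc Vw with m≤n⇒∃[o]m+o≡n (≤-trans (m≤m+n q a) qa≤w)
  ... | t , refl = Sum.map (shift a) (Sum.map (shift b) (shift c))
                     (onlyABC (p + t) (+-monoʳ-≤ p a≤t) (+-monoʳ-≤ p t≤c)
                       (subst (F ℓ ≤_) (sym (agreeOn a≤t t≤c)) Vw))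
    where
    a≤t = +-cancelˡ-≤ q a t qa≤w
    t≤c = +-cancelˡ-≤ q t c w≤qc
    shift : ∀ s → p + t ≡ p + s → q + t ≡ q + s
    shift s = cong (q +_) ∘ +-cancelˡ-≡ p t s

-- The alternatives (i)-(iv) of the proposition, over the ᾱ-values and differences of x < y < z
-- rather than over x, y, z themselves, so that ShapeOf-cong can move them between triples.
Dip : (ℓ αx αy αz dxz : ℕ) → Set
Dip ℓ αx αy αz dxz = F (suc ℓ) ≤ αx × αy ≡ F ℓ × F (suc ℓ) ≤ αz × dxz ≡ F ℓ

Peak : (ℓ αx αy αz dxy dyz : ℕ) → Set
Peak ℓ αx αy αz dxy dyz = αx ≡ F ℓ × F (suc ℓ) ≤ αy × αz ≡ F ℓ × dxy ≡ dyz

Ascent : (ℓ αx αy αz dxy dyz : ℕ) → Set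
Ascent ℓ αx αy αz dxy dyz =
  αx ≡ F ℓ × αy ≡ F (suc ℓ) × F (suc (suc ℓ)) ≤ αz × dxy ≡ F (ℓ ∸ 1) × dyz ≡ F (ℓ ∸ 1)

Descent : (ℓ αx αy αz dxy dyz : ℕ) → Set
Descent ℓ αx αy αz dxy dyz =
  F (suc (suc ℓ)) ≤ αx × αy ≡ F (suc ℓ) × αz ≡ F ℓ × dxy ≡ F (ℓ ∸ 1) × dyz ≡ F (ℓ ∸ 1)

ShapeOf : (ℓ αx αy αz dxy dyz dxz : ℕ) → Set
ShapeOf ℓ αx αy αz dxy dyz dxz =
  Dip ℓ αx αy αz dxz ⊎ Peak ℓ αx αy αz dxy dyz ⊎
  Ascent ℓ αx αy αz dxy dyz ⊎ Descent ℓ αx αy αz dxy dyz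

AllV : (ℓ x y z : ℕ) → Set
AllV ℓ x y z = V ℓ x × V ℓ y × V ℓ z

Shape : (ℓ x y z : ℕ) → Set
Shape ℓ x y z = ShapeOf ℓ (alphaBar x) (alphaBar y) (alphaBar z) (y ∸ x) (z ∸ y) (z ∸ x)

pattern dip p q r s = inj₁ (p , q , r , s)
pattern peak p q r s = inj₂ (inj₁ (p , q , r , s))
pattern ascent p q r s t = inj₂ (inj₂ (inj₁ (p , q , r , s , t)))
pattern descent p q r s t = inj₂ (inj₂ (inj₂ (p , q , r , s , t)))

ShapeOf-exclusive : ∀ {ℓ αx αy αz dxy dyz dxz} → 0 < ℓ → ShapeOf ℓ αx αy αz dxy dyz dxz →
  ExactlyOne4 (Dip ℓ αx αy αz dxz) (Peak ℓ αx αy αz dxy dyz)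
              (Ascent ℓ αx αy αz dxy dyz) (Descent ℓ αx αy αz dxy dyz)
ShapeOf-exclusive {ℓ} 0<ℓ shape =
  shape ,
  (λ ((_ , αy≡ , _) , (_ , ≤αy , _)) → ≤⇒≯ (≤-trans ≤αy (≤-reflexive αy≡)) F<F₁) ,
  (λ ((≤αx , _) , (αx≡ , _)) → ≤⇒≯ (≤-trans ≤αx (≤-reflexive αx≡)) F<F₁) ,
  (λ ((_ , αy≡ , _) , (_ , αy≡′ , _)) → <-irrefl (trans (sym αy≡) αy≡′) F<F₁) ,
  (λ ((_ , _ , αz≡ , _) , (_ , _ , ≤αz , _)) → ≤⇒≯ (≤-trans ≤αz (≤-reflexive αz≡)) F<F₂) ,
  (λ ((αx≡ , _) , (≤αx , _)) → ≤⇒≯ (≤-trans ≤αx (≤-reflexive αx≡)) F<F₂) ,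
  (λ ((αx≡ , _) , (≤αx , _)) → ≤⇒≯ (≤-trans ≤αx (≤-reflexive αx≡)) F<F₂)
  where
  F<F₁ : F ℓ < F (suc ℓ)
  F<F₁ = F-mono-< 0<ℓ (n<1+n ℓ)
  F<F₂ : F ℓ < F (suc (suc ℓ))
  F<F₂ = F-mono-< 0<ℓ (m<n⇒m<1+n (n<1+n ℓ))

ShapeOf-cong : ∀ {ℓ αx αy αz dxy dyz dxz αx′ αy′ αz′ dxy′ dyz′ dxz′} →
  αx ≡ αx′ → αy ≡ αy′ → αz ≡ αz′ → dxy ≡ dxy′ → dyz ≡ dyz′ → dxz ≡ dxz′ →
  ShapeOf ℓ αx αy αz dxy dyz dxz → ShapeOf ℓ αx′ αy′ αz′ dxy′ dyz′ dxz′
ShapeOf-cong refl refl refl refl refl refl shape = shape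

Shape-transport : ∀ {ℓ} p q {d a b c} → Agree p q d → 0 < a → c < d →
  (Consecutive3 ℓ (q + a) (q + b) (q + c) → ¬ AllV (1 + ℓ) (q + a) (q + b) (q + c) →
   Shape ℓ (q + a) (q + b) (q + c)) →
  Consecutive3 ℓ (p + a) (p + b) (p + c) → ¬ AllV (1 + ℓ) (p + a) (p + b) (p + c) →
  Shape ℓ (p + a) (p + b) (p + c)
Shape-transport {ℓ} p q {d} {a} {b} {c} agree 0<a c<d shape-q C notAll =
  ShapeOf-cong {ℓ} (sym ea) (sym eb) (sym ec) (translate b a) (translate c b) (translate c a)
    (shape-q (Consecutive3-transport {ℓ} p q agree 0<a c<d C) (notAll ∘ transport))
  where
  a<b = +-cancelˡ-< p a b (proj₁ C)
  b<c = +-cancelˡ-< p b c (proj₁ (proj₂ C))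
  ea = agree 0<a (<-trans a<b (<-trans b<c c<d))
  eb = agree (<-trans 0<a a<b) (<-trans b<c c<d)
  ec = agree (<-trans 0<a (<-trans a<b b<c)) c<d
  translate : ∀ s t → q + s ∸ (q + t) ≡ p + s ∸ (p + t)
  translate s t = trans ([m+n]∸[m+o]≡n∸o q s t) (sym ([m+n]∸[m+o]≡n∸o p s t))
  transport : AllV (1 + ℓ) (q + a) (q + b) (q + c) → AllV (1 + ℓ) (p + a) (p + b) (p + c)
  transport (Va , Vb , Vc) =
    subst (F (1 + ℓ) ≤_) (sym ea) Va , subst (F (1 + ℓ) ≤_) (sym eb) Vb ,
    subst (F (1 + ℓ) ≤_) (sym ec) Vc

record Above (ℓ p a u b v : ℕ) : Set where
  field
    gap₁ : Gap ℓ p (p + a)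
    gap₂ : Gap ℓ (p + a) (p + b)
    value₁ : alphaBar (p + a) ≡ u
    value₂ : alphaBar (p + b) ≡ v

  next₁ : 0 < a → F ℓ ≤ u → Next ℓ p (p + a)
  next₁ 0<a ℓ≤u = m<m+n p 0<a , gap₁ , subst (F ℓ ≤_) (sym value₁) ℓ≤u

  next₂ : a < b → F ℓ ≤ v → Next ℓ (p + a) (p + b)
  next₂ a<b ℓ≤v = +-monoʳ-< p a<b , gap₂ , subst (F ℓ ≤_) (sym value₂) ℓ≤v

record Below (ℓ p a u b v : ℕ) : Set where
  field
    gap₁ : Gap ℓ (p ∸ a) p
    gap₂ : Gap ℓ (p ∸ b) (p ∸ a)
    value₁ : alphaBar (p ∸ a) ≡ u
    value₂ : alphaBar (p ∸ b) ≡ v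

  next₁ : 0 < a → a ≤ p → V ℓ p → Next ℓ (p ∸ a) p
  next₁ 0<a a≤p Vp = ∸-monoʳ-< 0<a a≤p , gap₁ , Vp

  next₂ : a < b → b ≤ p → F ℓ ≤ u → Next ℓ (p ∸ b) (p ∸ a)
  next₂ a<b b≤p ℓ≤u = ∸-monoʳ-< a<b b≤p , gap₂ , subst (F ℓ ≤_) (sym value₁) ℓ≤u

Above-shift : ∀ {ℓ} j {a u b v} → 0 < a → a < b → b < F (2 + j) →
              Above ℓ (F j) a u b v → Above ℓ (F (3 + j)) a u b v
Above-shift {ℓ} j 0<a a<b b<F above = record
  { gap₁ = Gap-transport₀ {ℓ} (F (3 + j)) (F j) (alphaBar-shift j) (<⇒≤ (<-trans a<b b<F)) gap₁
  ; gap₂ = Gap-transport {ℓ} (F (3 + j)) (F j) (alphaBar-shift j) (<⇒≤ b<F) gap₂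
  ; value₁ = trans (alphaBar-shift j 0<a (<-trans a<b b<F)) value₁
  ; value₂ = trans (alphaBar-shift j (<-trans 0<a a<b) b<F) value₂
  }
  where open Above above

Above⇒Below : ∀ {ℓ} k {a u b v} → 0 < a → a < b → b < F (1 + k) →
              Above ℓ (F (2 + k)) a u b v → Below ℓ (F (2 + k)) a u b v
Above⇒Below {ℓ} k 0<a a<b b<F above = record
  { gap₁ = Gap-reflect {ℓ} (alphaBar-mirror k) z≤n (<⇒≤ (<-trans a<b b<F)) (≤-trans (<⇒≤ a<b) b≤p)
                       (Gap-⊆ {ℓ} (≤-reflexive (sym (+-identityʳ (F (2 + k))))) ≤-refl gap₁)
  ; gap₂ = Gap-reflect {ℓ} (alphaBar-mirror k) (<⇒≤ a<b) (<⇒≤ b<F) b≤p gap₂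
  ; value₁ = trans (alphaBar-mirror k 0<a (<-trans a<b b<F)) value₁
  ; value₂ = trans (alphaBar-mirror k (<-trans 0<a a<b) b<F) value₂
  }
  where
  open Above above
  b≤p = ≤-trans (<⇒≤ b<F) (F-≤-suc (1 + k))

infix 4 _≤₃_
data _≤₃_ (j : ℕ) : ℕ → Set where
  ≤₃-refl : j ≤₃ j
  ≤₃-step : ∀ {i} → j ≤₃ i → j ≤₃ 3 + i

≤₃⇒≤ : ∀ {j i} → j ≤₃ i → j ≤ i
≤₃⇒≤ ≤₃-refl = ≤-refl
≤₃⇒≤ (≤₃-step j≤₃i) = ≤-trans (≤₃⇒≤ j≤₃i) (m≤n+m _ 3)

≤₃-cases : ∀ {j i} → j < i → j ≤₃ i ⊎ 1 + j ≤₃ i ⊎ 2 + j ≤₃ i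
≤₃-cases {j} {i} j<i =
  subst (λ i → j ≤₃ i ⊎ 1 + j ≤₃ i ⊎ 2 + j ≤₃ i) (m∸n+n≡m j<i) (cases (i ∸ suc j))
  where
  cases : ∀ d → j ≤₃ d + suc j ⊎ 1 + j ≤₃ d + suc j ⊎ 2 + j ≤₃ d + suc j
  cases 0 = inj₂ (inj₁ ≤₃-refl)
  cases 1 = inj₂ (inj₂ ≤₃-refl)
  cases 2 = inj₁ (≤₃-step ≤₃-refl)
  cases (suc (suc (suc d))) = Sum.map ≤₃-step (Sum.map ≤₃-step ≤₃-step) (cases d)

V-F-step : ∀ {ℓ j i} → ℓ ≤ 3 + j → j ≤₃ i → V ℓ (F (3 + i))
V-F-step ℓ≤3+j j≤₃i = V-F (≤-trans ℓ≤3+j (+-monoʳ-≤ 3 (≤₃⇒≤ j≤₃i)))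

module Periodic {ℓ} (j : ℕ) {a u b v} (0<a : 0 < a) (a<b : a < b) (b<F : b < F (2 + j))
                (base : Above ℓ (F j) a u b v) (ℓ≤u : F ℓ ≤ u) (ℓ≤v : F ℓ ≤ v) where

  b<F[2+_] : ∀ {i} → j ≤₃ i → b < F (2 + i)
  b<F[2+_] j≤₃i = <-≤-trans b<F (F-mono-≤ (s≤s (s≤s (≤₃⇒≤ j≤₃i))))

  b≤F[3+_] : ∀ {i} → j ≤₃ i → b ≤ F (3 + i)
  b≤F[3+_] {i} j≤₃i = ≤-trans (<⇒≤ b<F[2+ j≤₃i ]) (F-≤-suc (2 + i))

  a≤F[3+_] : ∀ {i} → j ≤₃ i → a ≤ F (3 + i)
  a≤F[3+_] j≤₃i = ≤-trans (<⇒≤ a<b) b≤F[3+ j≤₃i ]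

  Above-periodic : ∀ {i} → j ≤₃ i → Above ℓ (F i) a u b v
  Above-periodic ≤₃-refl = base
  Above-periodic (≤₃-step {i} j≤₃i) = Above-shift i 0<a a<b b<F[2+ j≤₃i ] (Above-periodic j≤₃i)

  Below-periodic : ∀ {i} → j ≤₃ i → Below ℓ (F (3 + i)) a u b v
  Below-periodic {i} j≤₃i =
    Above⇒Below (1 + i) 0<a a<b b<F[2+ j≤₃i ] (Above-periodic (≤₃-step j≤₃i))

  chain-above : ∀ {i} → j ≤₃ i → V ℓ (F i) → Chain ℓ (F i) (F i + a) (F i + b)
  chain-above j≤₃i VFi = VFi , next₁ 0<a ℓ≤u , next₂ a<b ℓ≤v
    where open Above (Above-periodic j≤₃i)

  chain-below : ∀ {i} → j ≤₃ i → V ℓ (F (3 + i)) →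
                Chain ℓ (F (3 + i) ∸ b) (F (3 + i) ∸ a) (F (3 + i))
  chain-below j≤₃i VFi =
    subst (F ℓ ≤_) (sym value₂) ℓ≤v , next₂ a<b b≤F[3+ j≤₃i ] ℓ≤u , next₁ 0<a a≤F[3+ j≤₃i ] VFi
    where open Below (Below-periodic j≤₃i)

  chain-around : ∀ {i} → j ≤₃ i → V ℓ (F (3 + i)) →
                 Chain ℓ (F (3 + i) ∸ a) (F (3 + i)) (F (3 + i) + a)
  chain-around j≤₃i VFi =
    subst (F ℓ ≤_) (sym (Below.value₁ below)) ℓ≤u , Below.next₁ below 0<a a≤F[3+ j≤₃i ] VFi ,
    Above.next₁ (Above-periodic (≤₃-step j≤₃i)) 0<a ℓ≤u
    where below = Below-periodic j≤₃i

m+[n+n]∸[m+n]≡n : ∀ m n → m + (n + n) ∸ (m + n) ≡ n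
m+[n+n]∸[m+n]≡n m n = trans ([m+n]∸[m+o]≡n∸o m (n + n) n) (m+n∸m≡n n n)

m∸n∸[m∸[n+n]]≡n : ∀ {m n} → n + n ≤ m → m ∸ n ∸ (m ∸ (n + n)) ≡ n
m∸n∸[m∸[n+n]]≡n {m} {n} n+n≤m =
  trans (cong (m ∸ n ∸_) (sym (∸-+-assoc m n n))) (m∸[m∸n]≡n (m+n≤o⇒m≤o∸n n n+n≤m))

offset : ∀ {p x} → p < x → ∃ λ a → 0 < a × p + a ≡ x
offset p<x = _ , m<n⇒0<n∸m p<x , m+[n∸m]≡n (<⇒≤ p<x)

-- With ℓ = 2 + n, F n and F (1 + n) are the paper's F_{ℓ-2} and F_{ℓ-1}; Modₖ handles F i for
-- i ≡ ℓ + k (mod 3), with base cases i = ℓ, 1 + ℓ and ℓ - 1.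
module Classification (n : ℕ) where

  ℓ : ℕ
  ℓ = 2 + n

  gap-above-F[1+ℓ] : Gap ℓ (F (1 + ℓ)) (F (1 + ℓ) + F (1 + n))
  gap-above-F[1+ℓ] = Gap-transport₀ {ℓ} (F (3 + n)) (F n) (alphaBar-shift n) (F-≤-suc (1 + n))
                       (Gap-below {ℓ} (≤-reflexive (+-comm (F n) (F (1 + n)))))

  alphaBar-above-F[1+ℓ] : alphaBar (F (1 + ℓ) + F (1 + n)) ≡ F ℓ
  alphaBar-above-F[1+ℓ] = trans (alphaBar-shift n (F-pos (1 + n)) (F-<-suc n))
                            (trans (cong alphaBar (+-comm (F n) (F (1 + n)))) (alphaBar-F ℓ))

  Next-F[ℓ] : Next ℓ (F ℓ) (F (1 + ℓ))
  Next-F[ℓ] = F-<-suc (1 + n) , Gap-F n , V-F (n≤1+n ℓ)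

  Above-F[ℓ] : Above ℓ (F ℓ) (F (1 + n)) (F (1 + ℓ)) (F (1 + n) + F (1 + n)) (F ℓ)
  Above-F[ℓ] = record
    { gap₁ = Gap-F n
    ; gap₂ = Gap-⊆ {ℓ} ≤-refl (≤-reflexive (sym reassoc)) gap-above-F[1+ℓ]
    ; value₁ = alphaBar-F (1 + ℓ)
    ; value₂ = trans (cong alphaBar (sym reassoc)) alphaBar-above-F[1+ℓ]
    }
    where
    reassoc = +-assoc (F ℓ) (F (1 + n)) (F (1 + n))

  Above-F[1+ℓ] : Above ℓ (F (1 + ℓ)) (F (1 + n)) (F ℓ) (F ℓ) (F (2 + ℓ))
  Above-F[1+ℓ] = record
    { gap₁ = gap-above-F[1+ℓ]
    ; gap₂ = Gap-transport {ℓ} (F (3 + n)) (F n) (alphaBar-shift n) ≤-refl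
               (Gap-⊆ {ℓ} (≤-reflexive (+-comm (F (1 + n)) (F n))) Fn+Fℓ≤ (Gap-F n))
    ; value₁ = alphaBar-above-F[1+ℓ]
    ; value₂ = alphaBar-F (2 + ℓ)
    }
    where
    Fn+Fℓ≤ : F n + F ℓ ≤ F (1 + ℓ)
    Fn+Fℓ≤ = subst (_≤ F (1 + ℓ)) (+-comm (F ℓ) (F n)) (+-monoʳ-≤ (F ℓ) (F-≤-suc n))

  Above-F[1+n] : Above ℓ (F (1 + n)) (F n) (F ℓ) (F ℓ) (F (1 + ℓ))
  Above-F[1+n] = record
    { gap₁ = Gap-below {ℓ} ≤-refl
    ; gap₂ = Gap-⊆ {ℓ} ≤-refl (≤-reflexive (+-comm (F (1 + n)) (F ℓ))) (Gap-F n)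
    ; value₁ = alphaBar-F ℓ
    ; value₂ = trans (cong alphaBar (+-comm (F (1 + n)) (F ℓ))) (alphaBar-F (1 + ℓ))
    }

  F[1+n]<2F[1+n] : F (1 + n) < F (1 + n) + F (1 + n)
  F[1+n]<2F[1+n] = m<m+n _ (F-pos (1 + n))

  2F[1+n]<F[2+ℓ] : F (1 + n) + F (1 + n) < F (2 + ℓ)
  2F[1+n]<F[2+ℓ] = ≤-<-trans (+-monoˡ-≤ (F (1 + n)) (F-≤-suc (1 + n))) (F-<-suc ℓ)

  F[ℓ]<F[3+ℓ] : F ℓ < F (3 + ℓ)
  F[ℓ]<F[3+ℓ] = F-mono-< (s≤s z≤n) (m<n+m ℓ {3} (s≤s z≤n))

  F[n]<F[ℓ] : F n < F ℓ
  F[n]<F[ℓ] = ≤-<-trans (F-≤-suc n) (F-<-suc n)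

  F[ℓ]≤F[1+ℓ] : F ℓ ≤ F (1 + ℓ)
  F[ℓ]≤F[1+ℓ] = F-≤-suc ℓ

  F[ℓ]≤F[2+ℓ] : F ℓ ≤ F (2 + ℓ)
  F[ℓ]≤F[2+ℓ] = F-mono-≤ (m≤n+m ℓ 2)

  module Mod₀ = Periodic ℓ (F-pos (1 + n)) F[1+n]<2F[1+n] 2F[1+n]<F[2+ℓ] Above-F[ℓ]
                  F[ℓ]≤F[1+ℓ] ≤-refl
  module Mod₁ = Periodic (1 + ℓ) (F-pos (1 + n)) (F-<-suc n) F[ℓ]<F[3+ℓ] Above-F[1+ℓ]
                  ≤-refl F[ℓ]≤F[2+ℓ]
  module Mod₂ = Periodic (1 + n) (F-pos n) F[n]<F[ℓ] (F-<-suc (1 + n)) Above-F[1+n]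
                  ≤-refl F[ℓ]≤F[1+ℓ]

  shape-mod₀ : ∀ {i x y z} → ℓ ≤₃ i → Chain ℓ x y z → ¬ AllV (1 + ℓ) x y z →
               F i ≡ x ⊎ F i ≡ y ⊎ F i ≡ z → Shape ℓ x y z
  shape-mod₀ ≤₃-refl C _ (inj₁ refl)
    with Chain-≡ {ℓ} (Mod₀.chain-above ≤₃-refl (V-F (≤-refl {ℓ}))) C (inj₁ refl)
  ... | _ , refl , refl = let open Above Above-F[ℓ] in
    peak (alphaBar-F ℓ) (≤-reflexive (sym value₁)) value₂
         (trans (m+n∸m≡n (F ℓ) (F (1 + n))) (sym (m+[n+n]∸[m+n]≡n (F ℓ) (F (1 + n)))))
  shape-mod₀ ≤₃-refl (Vx , (x<y , _) , _) _ (inj₂ (inj₁ refl)) =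
    contradiction (V⇒F≤ {ℓ} Vx) (<⇒≱ x<y)
  shape-mod₀ ≤₃-refl (Vx , (x<y , _) , (y<z , _)) _ (inj₂ (inj₂ refl)) =
    contradiction (V⇒F≤ {ℓ} Vx) (<⇒≱ (<-trans x<y y<z))
  shape-mod₀ (≤₃-step {i} s) C _ (inj₁ refl)
    with Chain-≡ {ℓ} (Mod₀.chain-above (≤₃-step s) (V-F-step (m≤n+m ℓ 3) s)) C (inj₁ refl)
  ... | _ , refl , refl = let open Above (Mod₀.Above-periodic (≤₃-step s)) in
    descent (V-F-step (m≤n+m (2 + ℓ) 1) s) value₁ value₂
            (m+n∸m≡n (F (3 + i)) (F (1 + n))) (m+[n+n]∸[m+n]≡n (F (3 + i)) (F (1 + n)))
  shape-mod₀ (≤₃-step s) C notAll (inj₂ (inj₁ refl))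
    with Chain-≡ {ℓ} (Mod₀.chain-around s (V-F-step (m≤n+m ℓ 3) s)) C (inj₂ (inj₁ refl))
  ... | refl , _ , refl =
    contradiction (≤-reflexive (sym (Below.value₁ (Mod₀.Below-periodic s))) ,
                   V-F-step (m≤n+m (1 + ℓ) 2) s ,
                   ≤-reflexive (sym (Above.value₁ (Mod₀.Above-periodic (≤₃-step s))))) notAll
  shape-mod₀ (≤₃-step s) C _ (inj₂ (inj₂ refl))
    with Chain-≡ {ℓ} (Mod₀.chain-below s (V-F-step (m≤n+m ℓ 3) s)) C (inj₂ (inj₂ refl))
  ... | refl , refl , _ = let open Below (Mod₀.Below-periodic s) in
    ascent value₂ value₁ (V-F-step (m≤n+m (2 + ℓ) 1) s)
           (m∸n∸[m∸[n+n]]≡n Mod₀.b≤F[3+ s ]) (m∸[m∸n]≡n Mod₀.a≤F[3+ s ])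

  shape-mod₁ : ∀ {i x y z} → 1 + ℓ ≤₃ i → Chain ℓ x y z → F i ≡ x ⊎ F i ≡ y ⊎ F i ≡ z → Shape ℓ x y z
  shape-mod₁ {i} s C (inj₁ refl)
    with Chain-≡ {ℓ} (Mod₁.chain-above s (V-F (≤-trans (n≤1+n ℓ) (≤₃⇒≤ s)))) C (inj₁ refl)
  ... | _ , refl , refl = let open Above (Mod₁.Above-periodic s) in
    dip (V-F (≤₃⇒≤ s)) value₁ (≤-trans (F-≤-suc (1 + ℓ)) (≤-reflexive (sym value₂)))
        (m+n∸m≡n (F i) (F ℓ))
  shape-mod₁ ≤₃-refl C (inj₂ (inj₁ refl))
    with Chain-≡ {ℓ} (V-F (≤-refl {ℓ}) , Next-F[ℓ] , Above.next₁ Above-F[1+ℓ] (F-pos (1 + n)) ≤-refl)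
                     C (inj₂ (inj₁ refl))
  ... | refl , _ , refl =
    peak (alphaBar-F ℓ) (V-F (≤-refl {1 + ℓ})) (Above.value₁ Above-F[1+ℓ])
         (trans (m+n∸m≡n (F ℓ) (F (1 + n))) (sym (m+n∸m≡n (F (1 + ℓ)) (F (1 + n)))))
  shape-mod₁ (≤₃-step {i} s) C (inj₂ (inj₁ refl))
    with Chain-≡ {ℓ} (Mod₁.chain-around s (V-F-step (m≤n+m ℓ 4) s)) C (inj₂ (inj₁ refl))
  ... | refl , _ , refl =
    peak (Below.value₁ (Mod₁.Below-periodic s)) (V-F-step (m≤n+m (1 + ℓ) 3) s)
         (Above.value₁ (Mod₁.Above-periodic (≤₃-step s)))
         (trans (m∸[m∸n]≡n Mod₁.a≤F[3+ s ]) (sym (m+n∸m≡n (F (3 + i)) (F (1 + n)))))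
  shape-mod₁ ≤₃-refl (Vx , (x<y , _ , Vy) , yz) (inj₂ (inj₂ refl))
    with Next-injective {ℓ} Vy (V-F (≤-refl {ℓ})) yz Next-F[ℓ]
  ... | refl = contradiction (V⇒F≤ {ℓ} Vx) (<⇒≱ x<y)
  shape-mod₁ (≤₃-step s) C (inj₂ (inj₂ refl))
    with Chain-≡ {ℓ} (Mod₁.chain-below s (V-F-step (m≤n+m ℓ 4) s)) C (inj₂ (inj₂ refl))
  ... | refl , refl , _ = let open Below (Mod₁.Below-periodic s) in
    dip (≤-trans (F-≤-suc (1 + ℓ)) (≤-reflexive (sym value₂))) value₁
        (V-F-step (m≤n+m (1 + ℓ) 3) s) (m∸[m∸n]≡n Mod₁.b≤F[3+ s ])

  shape-mod₂ : ∀ {i x y z} → 1 + n ≤₃ i → Chain ℓ x y z → F i ≡ x ⊎ F i ≡ y ⊎ F i ≡ z → Shape ℓ x y z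
  shape-mod₂ ≤₃-refl C pos =
    contradiction (Chain-V {ℓ} C pos) (<⇒≱ (subst (_< F ℓ) (sym (alphaBar-F (1 + n))) (F-<-suc n)))
  shape-mod₂ (≤₃-step {i} s) C (inj₁ refl)
    with Chain-≡ {ℓ} (Mod₂.chain-above (≤₃-step s) (V-F-step (m≤n+m ℓ 2) s)) C (inj₁ refl)
  ... | _ , refl , refl = let open Above (Mod₂.Above-periodic (≤₃-step s)) in
    dip (V-F-step (m≤n+m (1 + ℓ) 1) s) value₁ (≤-reflexive (sym value₂)) (m+n∸m≡n (F (3 + i)) (F ℓ))
  shape-mod₂ (≤₃-step {i} s) C (inj₂ (inj₁ refl))
    with Chain-≡ {ℓ} (Mod₂.chain-around s (V-F-step (m≤n+m ℓ 2) s)) C (inj₂ (inj₁ refl))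
  ... | refl , _ , refl =
    peak (Below.value₁ (Mod₂.Below-periodic s)) (V-F-step (m≤n+m (1 + ℓ) 1) s)
         (Above.value₁ (Mod₂.Above-periodic (≤₃-step s)))
         (trans (m∸[m∸n]≡n Mod₂.a≤F[3+ s ]) (sym (m+n∸m≡n (F (3 + i)) (F n))))
  shape-mod₂ (≤₃-step s) C (inj₂ (inj₂ refl))
    with Chain-≡ {ℓ} (Mod₂.chain-below s (V-F-step (m≤n+m ℓ 2) s)) C (inj₂ (inj₂ refl))
  ... | refl , refl , _ = let open Below (Mod₂.Below-periodic s) in
    dip (≤-reflexive (sym value₂)) value₁ (V-F-step (m≤n+m (1 + ℓ) 1) s) (m∸[m∸n]≡n Mod₂.b≤F[3+ s ])

  shape-at-F : ∀ i {x y z} → Chain ℓ x y z → ¬ AllV (1 + ℓ) x y z →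
               F i ≡ x ⊎ F i ≡ y ⊎ F i ≡ z → Shape ℓ x y z
  shape-at-F i C notAll pos with ≤₃-cases ℓ≤i
    where
    ℓ≤i : ℓ ≤ i
    ℓ≤i = F-cancel-≤ (m≤m+n 2 n) (subst (F ℓ ≤_) (alphaBar-F i) (Chain-V {ℓ} C pos))
  ... | inj₁ s = shape-mod₂ s C pos
  ... | inj₂ (inj₁ s) = shape-mod₀ s C notAll pos
  ... | inj₂ (inj₂ s) = shape-mod₁ s C pos

  -- Either F (4 + j) ∈ (x, z], and then it is y or z, or the triple lies in (F (3 + j), F (4 + j))
  -- and is the shifted copy of a triple starting at F j + a < x.
  shape : ∀ {x y z} → Acc _<_ x → Consecutive3 ℓ x y z → ¬ AllV (1 + ℓ) x y z → Shape ℓ x y z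
  shape {x} {y} {z} (acc rec) C@(x<y , y<z , Vx , _ , _ , onlyXYZ) notAll
    with F-locate x (≤-trans (F-mono-≤ (m≤m+n 2 n)) (V⇒F≤ {ℓ} Vx))
  ... | inj₁ (i , refl) = shape-at-F i (Consecutive3⇒Chain {ℓ} C) notAll (inj₁ refl)
  ... | inj₂ (j , F<x , x<F) with F (4 + j) ≤? z
  ...   | yes F≤z =
    shape-at-F (4 + j) (Consecutive3⇒Chain {ℓ} C) notAll (onlyXYZ (F (4 + j)) (<⇒≤ x<F) F≤z VF)
    where
    VF : V ℓ (F (4 + j))
    VF = subst (F ℓ ≤_) (sym (alphaBar-F (4 + j))) (≤-trans (V⇒F≤ {ℓ} Vx) (<⇒≤ x<F))
  ...   | no F≰z with offset F<x | offset (<-trans F<x x<y) | offset (<-trans F<x (<-trans x<y y<z))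
  ...     | a , 0<a , refl | b , _ , refl | c , _ , refl =
    Shape-transport {ℓ} (F (3 + j)) (F j) (alphaBar-shift j) 0<a c<F
      (shape (rec (+-monoˡ-< a Fj<F[3+j]))) C notAll
    where
    c<F : c < F (2 + j)
    c<F = +-cancelˡ-< (F (3 + j)) c (F (2 + j)) (≰⇒> F≰z)
    Fj<F[3+j] : F j < F (3 + j)
    Fj<F[3+j] = ≤-<-trans (F-≤-suc j) (<-≤-trans (F-<-suc j) (F-≤-suc (2 + j)))

proposition4p12 : (ℓ x y z : ℕ) → 2 ≤ ℓ → Consecutive3 ℓ x y z →
    ¬ (V (suc ℓ) x × V (suc ℓ) y × V (suc ℓ) z) →
    ExactlyOne4
      (F (suc ℓ) ≤ alphaBar x × alphaBar y ≡ F ℓ × F (suc ℓ) ≤ alphaBar z × z ∸ x ≡ F ℓ)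
      (alphaBar x ≡ F ℓ × F (suc ℓ) ≤ alphaBar y × alphaBar z ≡ F ℓ × y ∸ x ≡ z ∸ y)
      (alphaBar x ≡ F ℓ × alphaBar y ≡ F (suc ℓ) × F (suc (suc ℓ)) ≤ alphaBar z × y ∸ x ≡ F (ℓ ∸ 1) × z ∸ y ≡ F (ℓ ∸ 1))
      (F (suc (suc ℓ)) ≤ alphaBar x × alphaBar y ≡ F (suc ℓ) × alphaBar z ≡ F ℓ × y ∸ x ≡ F (ℓ ∸ 1) × z ∸ y ≡ F (ℓ ∸ 1))
proposition4p12 (suc zero) _ _ _ (s≤s ()) _ _
proposition4p12 (suc (suc n)) x y z _ C notAll =
  ShapeOf-exclusive {2 + n} (s≤s z≤n) (Classification.shape n (<-wellFounded x) C notAll)
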